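{- Let $k_1,k_2,l\in\mathbb{N}$ with $k_1+k_2-1\geq l$. Then, provided the finite sets $P$ (points) and $L$ (lines) are sufficiently large (i.e. there is a bound $N$, depending on $k_1,k_2,l$, such that the following holds whenever $|P|\geq N$ and $|L|\geq N$), setting $E=P\times L$, the collection $$\mathcal{I}=\{I\subseteq E: (P,L,I)\text{ is }(1,k_1,k_2,l)\text{ -sparse}\}$$ is the collection of independent sets of a matroid on the ground set $E$.
   Context: A rank $2$ incidence geometry is a triple $(P,L,I)$ with $P$ and $L$ finite disjoint sets and $I\subseteq P\times L$. For $I'\subseteq I$, its support is $P(I')\times L(I')$ where $P(I')=\{p:\exists \ell,\ (p,\ell)\in I'\}$ and $L(I')=\{\ell:\exists p,\ (p,\ell)\in I'\}$. $(P,L,I)$ is $(1,k_1,k_2,l)$-sparse if for every nonempty $I'\subseteq I$, $|I'|\leq k_1|P(I')|+k_2|L(I')|-l$. -}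

module Defs where

open import Data.Nat using (ℕ; zero; suc; _+_; _*_; _≤_; _<_)
open import Data.Fin using (Fin; _≟_)
open import Data.Bool using (Bool; true; false; if_then_else_; _∨_; _∧_)
open import Data.Product using (Σ; ∃; _×_; _,_)
open import Relation.Binary.PropositionalEquality using (_≡_)
open import Relation.Nullary.Decidable using (⌊_⌋)
open import Function using (_∘_)

count : ∀ {n} → (Fin n → Bool) → ℕ
count {zero}  f = 0
count {suc n} f = (if f Fin.zero then 1 else 0) + count (f ∘ Fin.suc)

sumFin : ∀ {n} → (Fin n → ℕ) → ℕ
sumFin {zero}  f = 0
sumFin {suc n} f = f Fin.zero + sumFin (f ∘ Fin.suc)

anyFin : ∀ {n} → (Fin n → Bool) → Bool
anyFin {zero}  f = false
anyFin {suc n} f = f Fin.zero ∨ anyFin (f ∘ Fin.suc)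

-- Points P = Fin m, lines L = Fin n, ground set E = P × L.
-- A subset of E (a set of incidences) is given by its characteristic function.
Inc : ℕ → ℕ → Set
Inc m n = Fin m → Fin n → Bool

module _ {m n : ℕ} where

  card : Inc m n → ℕ
  card I = sumFin (λ p → count (λ ℓ → I p ℓ))

  cardP : Inc m n → ℕ
  cardP I = count (λ p → anyFin (λ ℓ → I p ℓ))

  cardL : Inc m n → ℕ
  cardL I = count (λ ℓ → anyFin (λ p → I p ℓ))

  _⊆_ : Inc m n → Inc m n → Set
  A ⊆ B = ∀ p ℓ → A p ℓ ≡ true → B p ℓ ≡ true

  NonEmpty : Inc m n → Set
  NonEmpty A = Σ (Fin m) λ p → Σ (Fin n) λ ℓ → A p ℓ ≡ true

  ∅ : Inc m n
  ∅ p ℓ = false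

  insert : Inc m n → Fin m → Fin n → Inc m n
  insert A p ℓ p' ℓ' = A p' ℓ' ∨ (⌊ p' ≟ p ⌋ ∧ ⌊ ℓ' ≟ ℓ ⌋)

  -- (P , L , I) is (1,k₁,k₂,l)-sparse: for every nonempty I' ⊆ I,
  -- |I'| ≤ k₁|P(I')| + k₂|L(I')| - l   (stated as |I'| + l ≤ …, integer subtraction)
  Sparse : ℕ → ℕ → ℕ → Inc m n → Set
  Sparse k₁ k₂ l I =
    ∀ (I' : Inc m n) → I' ⊆ I → NonEmpty I' →
    card I' + l ≤ k₁ * cardP I' + k₂ * cardL I'

  record IsMatroid (Ind : Inc m n → Set) : Set where
    field
      empty-ind : Ind ∅
      down-closed : ∀ A B → A ⊆ B → Ind B → Ind A
      augment : ∀ A B → Ind A → Ind B → card A < card B →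
        Σ (Fin m) λ p → Σ (Fin n) λ ℓ →
          (B p ℓ ≡ true) × (A p ℓ ≡ false) × Ind (insert A p ℓ)

-- The weight w(I) = k₁|P(I)| + k₂|L(I)| is monotone and submodular, so two
-- "tight" sets (w ≤ |·| + l) inside a sparse set that meet have a tight union.
-- Augmentation for sparse A, B with |A| < |B| goes by induction on |A|.  Take
-- e ∈ B ∖ A.  If A + e is not sparse, a violating subset minus e is a nonempty
-- tight subset of A whose span (the pairs whose addition does not raise w)
-- contains e; enlarge it to a maximal tight Y ⊆ A.  Sparsity of B bounds
-- |B ∩ span Y| by |Y|, so the induction hypothesis applies to A ∖ Y and
-- B ∖ span Y and yields some e'.  Then A + e' is sparse: an obstruction to it
-- meeting Y would be absorbed by Y and put e' into span Y, and one avoiding Y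
-- would already obstruct (A ∖ Y) + e'.  The hypothesis l < k₁ + k₂ makes the
-- tight remnant nonempty.
module Submission where

open import Defs
open import Data.Nat using (ℕ; zero; suc; _+_; _*_; _≤_; _<_; _≤?_; _<?_; _≡ᵇ_; z≤n; s≤s)
open import Data.Nat.Properties hiding (_≟_)
open import Data.Fin using (Fin; _≟_) renaming (zero to fzero; suc to fsuc)
open import Data.Fin.Properties using (all?; any?) renaming (suc-injective to fsuc-injective)
open import Data.Bool using (Bool; true; false; if_then_else_; _∨_; _∧_; not)
open import Data.Bool.Properties using (∧-zeroʳ; ∧-identityʳ) renaming (_≟_ to _≟ᵇ_)
open import Data.Vec.Functional using (_∷_; head; tail)
open import Data.Product using (Σ; ∃; ∃₂; _×_; _,_; proj₁; proj₂)
open import Data.Sum using (_⊎_; inj₁; inj₂)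
open import Data.Empty using (⊥; ⊥-elim)
open import Relation.Binary.PropositionalEquality
  using (_≡_; _≢_; refl; sym; trans; cong; cong₂; subst; subst₂; module ≡-Reasoning)
open import Relation.Nullary using (¬_; Dec; yes; no; ¬?)
open import Relation.Nullary.Decidable using (⌊_⌋; _×-dec_; _→-dec_; map′; decidable-stable)
open import Function using (_∘_)
open import Algebra.Properties.CommutativeSemigroup +-commutativeSemigroup using (interchange)

∨-true⁻ : ∀ a {b} → a ∨ b ≡ true → a ≡ true ⊎ b ≡ true
∨-true⁻ true  _ = inj₁ refl
∨-true⁻ false e = inj₂ e

∨-trueˡ : ∀ {a} b → a ≡ true → a ∨ b ≡ true
∨-trueˡ _ refl = refl

∨-trueʳ : ∀ a {b} → b ≡ true → a ∨ b ≡ true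
∨-trueʳ true  _ = refl
∨-trueʳ false e = e

∧-true⁻ : ∀ a {b} → a ∧ b ≡ true → a ≡ true × b ≡ true
∧-true⁻ true  e = refl , e
∧-true⁻ false ()

∧-true : ∀ {a b} → a ≡ true → b ≡ true → a ∧ b ≡ true
∧-true refl refl = refl

+-≤⇒≤ˡ : ∀ {a b c d} → a + b ≤ c + d → d ≤ b → a ≤ c
+-≤⇒≤ˡ {a} {b} {c} {d} a+b≤c+d d≤b = +-cancelʳ-≤ b a c (≤-trans a+b≤c+d (+-monoʳ-≤ c d≤b))

+-≤⇒≤ʳ : ∀ {a b c d} → a + b ≤ c + d → c ≤ a → b ≤ d
+-≤⇒≤ʳ {a} {b} {c} {d} a+b≤c+d c≤a = +-cancelˡ-≤ a b d (≤-trans a+b≤c+d (+-monoˡ-≤ d c≤a))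

-- Counting over Fin

𝟙 : Bool → ℕ
𝟙 b = if b then 1 else 0

𝟙-mono : ∀ {a b} → (a ≡ true → b ≡ true) → 𝟙 a ≤ 𝟙 b
𝟙-mono {false} _ = z≤n
𝟙-mono {true}  h rewrite h refl = ≤-refl

𝟙-∨-∧ : ∀ a b → 𝟙 (a ∨ b) + 𝟙 (a ∧ b) ≡ 𝟙 a + 𝟙 b
𝟙-∨-∧ true  true  = refl
𝟙-∨-∧ true  false = refl
𝟙-∨-∧ false true  = refl
𝟙-∨-∧ false false = refl

sumFin-cong : ∀ {k} {f g : Fin k → ℕ} → (∀ i → f i ≡ g i) → sumFin f ≡ sumFin g
sumFin-cong {zero}  _ = refl
sumFin-cong {suc k} h = cong₂ _+_ (h fzero) (sumFin-cong (h ∘ fsuc))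

sumFin-mono : ∀ {k} {f g : Fin k → ℕ} → (∀ i → f i ≤ g i) → sumFin f ≤ sumFin g
sumFin-mono {zero}  _ = z≤n
sumFin-mono {suc k} h = +-mono-≤ (h fzero) (sumFin-mono (h ∘ fsuc))

sumFin-mono-< : ∀ {k} {f g : Fin k → ℕ} → (∀ i → f i ≤ g i) →
  ∀ j → f j < g j → sumFin f < sumFin g
sumFin-mono-< h fzero    lt = +-mono-<-≤ lt (sumFin-mono (h ∘ fsuc))
sumFin-mono-< h (fsuc j) lt = +-mono-≤-< (h fzero) (sumFin-mono-< (h ∘ fsuc) j lt)

sumFin-+ : ∀ {k} (f g : Fin k → ℕ) → sumFin (λ i → f i + g i) ≡ sumFin f + sumFin g
sumFin-+ {zero}  _ _ = refl
sumFin-+ {suc k} f g = trans (cong (f fzero + g fzero +_) (sumFin-+ (f ∘ fsuc) (g ∘ fsuc)))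
                             (interchange (f fzero) (g fzero) (sumFin (f ∘ fsuc)) (sumFin (g ∘ fsuc)))

sumFin-zero : ∀ {k} {f : Fin k → ℕ} → (∀ i → f i ≡ 0) → sumFin f ≡ 0
sumFin-zero {zero}  _ = refl
sumFin-zero {suc k} h = cong₂ _+_ (h fzero) (sumFin-zero (h ∘ fsuc))

sumFin-suc-at : ∀ {k} {f g : Fin k → ℕ} j → (∀ i → i ≢ j → f i ≡ g i) →
  f j ≡ suc (g j) → sumFin f ≡ suc (sumFin g)
sumFin-suc-at fzero h e = cong₂ _+_ e (sumFin-cong λ i → h (fsuc i) λ ())
sumFin-suc-at {suc k} {f} {g} (fsuc j) h e =
  trans (cong₂ _+_ (h fzero λ ()) (sumFin-suc-at j (λ i i≢j → h (fsuc i) (i≢j ∘ fsuc-injective)) e))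
        (+-suc (g fzero) (sumFin (g ∘ fsuc)))

count≡sumFin𝟙 : ∀ {k} (f : Fin k → Bool) → count f ≡ sumFin (𝟙 ∘ f)
count≡sumFin𝟙 {zero}  _ = refl
count≡sumFin𝟙 {suc k} f = cong (𝟙 (f fzero) +_) (count≡sumFin𝟙 (f ∘ fsuc))

module _ {k : ℕ} {f g : Fin k → Bool} where

  count-cong : (∀ i → f i ≡ g i) → count f ≡ count g
  count-cong h = begin
    count f          ≡⟨ count≡sumFin𝟙 f ⟩
    sumFin (𝟙 ∘ f)   ≡⟨ sumFin-cong (cong 𝟙 ∘ h) ⟩
    sumFin (𝟙 ∘ g)   ≡⟨ count≡sumFin𝟙 g ⟨
    count g          ∎
    where open ≡-Reasoning

  count-mono : (∀ i → f i ≡ true → g i ≡ true) → count f ≤ count g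
  count-mono h = subst₂ _≤_ (sym (count≡sumFin𝟙 f)) (sym (count≡sumFin𝟙 g))
                            (sumFin-mono λ i → 𝟙-mono (h i))

  count-mono-< : (∀ i → f i ≡ true → g i ≡ true) →
    ∀ j → f j ≡ false → g j ≡ true → count f < count g
  count-mono-< h j fj gj = subst₂ _<_ (sym (count≡sumFin𝟙 f)) (sym (count≡sumFin𝟙 g))
    (sumFin-mono-< (λ i → 𝟙-mono (h i)) j (subst₂ (λ a b → 𝟙 a < 𝟙 b) (sym fj) (sym gj) ≤-refl))

  count-∨-∧ : count (λ i → f i ∨ g i) + count (λ i → f i ∧ g i) ≡ count f + count g
  count-∨-∧ = begin
    count (λ i → f i ∨ g i) + count (λ i → f i ∧ g i)
      ≡⟨ cong₂ _+_ (count≡sumFin𝟙 (λ i → f i ∨ g i)) (count≡sumFin𝟙 (λ i → f i ∧ g i)) ⟩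
    sumFin (λ i → 𝟙 (f i ∨ g i)) + sumFin (λ i → 𝟙 (f i ∧ g i))
      ≡⟨ sumFin-+ (λ i → 𝟙 (f i ∨ g i)) (λ i → 𝟙 (f i ∧ g i)) ⟨
    sumFin (λ i → 𝟙 (f i ∨ g i) + 𝟙 (f i ∧ g i))
      ≡⟨ sumFin-cong (λ i → 𝟙-∨-∧ (f i) (g i)) ⟩
    sumFin (λ i → 𝟙 (f i) + 𝟙 (g i))
      ≡⟨ sumFin-+ (𝟙 ∘ f) (𝟙 ∘ g) ⟩
    sumFin (𝟙 ∘ f) + sumFin (𝟙 ∘ g)
      ≡⟨ cong₂ _+_ (count≡sumFin𝟙 f) (count≡sumFin𝟙 g) ⟨
    count f + count g ∎
    where open ≡-Reasoning

  count-suc-at : ∀ j → (∀ i → i ≢ j → f i ≡ g i) → f j ≡ true → g j ≡ false →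
    count f ≡ suc (count g)
  count-suc-at j h fj gj = begin
    count f          ≡⟨ count≡sumFin𝟙 f ⟩
    sumFin (𝟙 ∘ f)   ≡⟨ sumFin-suc-at j (λ i i≢j → cong 𝟙 (h i i≢j)) (trans (cong 𝟙 fj) (cong (suc ∘ 𝟙) (sym gj))) ⟩
    suc (sumFin (𝟙 ∘ g)) ≡⟨ cong suc (count≡sumFin𝟙 g) ⟨
    suc (count g)    ∎
    where open ≡-Reasoning

count-zero : ∀ {k} {f : Fin k → Bool} → (∀ i → f i ≡ false) → count f ≡ 0
count-zero {f = f} h = trans (count≡sumFin𝟙 f) (sumFin-zero (cong 𝟙 ∘ h))

count-pos : ∀ {k} {f : Fin k → Bool} j → f j ≡ true → 1 ≤ count f
count-pos {suc k} {f} fzero    fj rewrite fj = s≤s z≤n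
count-pos {suc k} {f} (fsuc j) fj = m≤n⇒m≤o+n (𝟙 (f fzero)) (count-pos j fj)

anyFin-witness : ∀ {k} {f : Fin k → Bool} → anyFin f ≡ true → ∃ λ i → f i ≡ true
anyFin-witness {suc k} {f} e with ∨-true⁻ (f fzero) e
... | inj₁ f0 = fzero , f0
... | inj₂ rest with anyFin-witness rest
...   | i , fi = fsuc i , fi

anyFin-intro : ∀ {k} {f : Fin k → Bool} i → f i ≡ true → anyFin f ≡ true
anyFin-intro fzero    e = ∨-trueˡ _ e
anyFin-intro {f = f} (fsuc i) e = ∨-trueʳ (f fzero) (anyFin-intro i e)

-- Exhaustive search

Searchable : (A : Set) → (A → A → Set) → Set₁
Searchable A _≈_ = (P : A → Set) → (∀ {x y} → x ≈ y → P x → P y) → (∀ x → Dec (P x)) → Dec (∃ P)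

searchable-Bool : Searchable Bool _≡_
searchable-Bool P _ P? with P? true | P? false
... | yes p  | _      = yes (true , p)
... | no _   | yes p  = yes (false , p)
... | no ¬pt | no ¬pf = no λ { (true , p) → ¬pt p ; (false , p) → ¬pf p }

-- Search is up to pointwise equivalence: without function extensionality a
-- predicate on functions need not respect it.
searchable-Fin→ : ∀ {A : Set} {_≈_ : A → A → Set} → (∀ x → x ≈ x) → Searchable A _≈_ →
  ∀ k → Searchable (Fin k → A) (λ f g → ∀ i → f i ≈ g i)
searchable-Fin→ ≈-refl search zero P resp P? =
  map′ (λ p → _ , p) (λ (f , p) → resp (λ ()) p) (P? λ ())
searchable-Fin→ {A} {_≈_} ≈-refl search (suc k) P resp P? =
  map′ (λ (a , g , p) → a ∷ g , p)
       (λ (f , p) → head f , tail f , resp (λ { fzero → ≈-refl _ ; (fsuc i) → ≈-refl _ }) p)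
       (search Extends resp-Extends λ a →
         searchable-Fin→ ≈-refl search k (λ g → P (a ∷ g))
           (λ g≈ → resp λ { fzero → ≈-refl a ; (fsuc i) → g≈ i }) (P? ∘ (a ∷_)))
  where
    Extends : A → Set
    Extends a = ∃ λ g → P (a ∷ g)

    resp-Extends : ∀ {a b} → a ≈ b → Extends a → Extends b
    resp-Extends a≈b (g , p) = g , resp (λ { fzero → a≈b ; (fsuc i) → ≈-refl (g i) }) p

-- Incidence sets

variable
  m n : ℕ
  A B X Y Z : Inc m n
  p : Fin m
  ℓ : Fin n

_≐_ : Inc m n → Inc m n → Set
X ≐ Y = ∀ p ℓ → X p ℓ ≡ Y p ℓ

infixl 30 _∪_ _∩_ _∖_

_∪_ _∩_ _∖_ : Inc m n → Inc m n → Inc m n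
(X ∪ Y) p ℓ = X p ℓ ∨ Y p ℓ
(X ∩ Y) p ℓ = X p ℓ ∧ Y p ℓ
(X ∖ Y) p ℓ = X p ℓ ∧ not (Y p ℓ)

-- insert A p ℓ is definitionally A ∪ single p ℓ.
single : Fin m → Fin n → Inc m n
single p ℓ p' ℓ' = ⌊ p' ≟ p ⌋ ∧ ⌊ ℓ' ≟ ℓ ⌋

transpose : Inc m n → Inc n m
transpose X ℓ p = X p ℓ

⊆-refl : X ⊆ X
⊆-refl _ _ e = e

⊆-trans : X ⊆ Y → Y ⊆ Z → X ⊆ Z
⊆-trans X⊆Y Y⊆Z p ℓ e = Y⊆Z p ℓ (X⊆Y p ℓ e)

⊆-∪ˡ : X ⊆ X ∪ Y
⊆-∪ˡ _ _ = ∨-trueˡ _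

∪-⊆ : X ⊆ Z → Y ⊆ Z → X ∪ Y ⊆ Z
∪-⊆ {X = X} X⊆Z Y⊆Z p ℓ e with ∨-true⁻ (X p ℓ) e
... | inj₁ Xpℓ = X⊆Z p ℓ Xpℓ
... | inj₂ Ypℓ = Y⊆Z p ℓ Ypℓ

∩-⊆ˡ : X ∩ Y ⊆ X
∩-⊆ˡ {X = X} p ℓ e = proj₁ (∧-true⁻ (X p ℓ) e)

∩-⊆ʳ : X ∩ Y ⊆ Y
∩-⊆ʳ {X = X} p ℓ e = proj₂ (∧-true⁻ (X p ℓ) e)

⊆-∩ : Z ⊆ X → Z ⊆ Y → Z ⊆ X ∩ Y
⊆-∩ Z⊆X Z⊆Y p ℓ e = ∧-true (Z⊆X p ℓ e) (Z⊆Y p ℓ e)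

∖-⊆ : X ∖ Y ⊆ X
∖-⊆ {X = X} p ℓ e = proj₁ (∧-true⁻ (X p ℓ) e)

⊆-transpose : X ⊆ Y → transpose X ⊆ transpose Y
⊆-transpose X⊆Y ℓ p = X⊆Y p ℓ

≐⇒⊆ : X ≐ Y → X ⊆ Y
≐⇒⊆ X≐Y p ℓ e = trans (sym (X≐Y p ℓ)) e

≐⇒⊇ : X ≐ Y → Y ⊆ X
≐⇒⊇ X≐Y p ℓ e = trans (X≐Y p ℓ) e

NonEmpty-mono : X ⊆ Y → NonEmpty X → NonEmpty Y
NonEmpty-mono X⊆Y (p , ℓ , e) = p , ℓ , X⊆Y p ℓ e

⊆-false : X ⊆ Y → Y p ℓ ≡ false → X p ℓ ≡ false
⊆-false {X = X} {p = p} {ℓ = ℓ} X⊆Y Ypℓ with X p ℓ in e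
... | true  = trans (sym (X⊆Y p ℓ e)) Ypℓ
... | false = refl

∖-true⁻ : (X ∖ Y) p ℓ ≡ true → X p ℓ ≡ true × Y p ℓ ≡ false
∖-true⁻ {X = X} {Y = Y} {p = p} {ℓ = ℓ} e with ∧-true⁻ (X p ℓ) e
... | Xpℓ , not-Ypℓ with Y p ℓ
...   | false = Xpℓ , refl

empty-false : ¬ NonEmpty X → ∀ p ℓ → X p ℓ ≡ false
empty-false {X = X} empty p ℓ with X p ℓ in e
... | true  = ⊥-elim (empty (p , ℓ , e))
... | false = refl

∖-false : (X ∖ Y) p ℓ ≡ false → Y p ℓ ≡ false → X p ℓ ≡ false
∖-false {X = X} {Y} {p} {ℓ} e Ypℓ =
  trans (sym (∧-identityʳ (X p ℓ))) (trans (cong (λ b → X p ℓ ∧ not b) (sym Ypℓ)) e)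

⊆-∖ : X ⊆ A → ¬ NonEmpty (Y ∩ X) → X ⊆ A ∖ Y
⊆-∖ {X = X} {Y = Y} X⊆A disjoint p ℓ Xpℓ = ∧-true (X⊆A p ℓ Xpℓ) (cong not Ypℓ)
  where
    Ypℓ : Y p ℓ ≡ false
    Ypℓ with Y p ℓ in e
    ... | true  = ⊥-elim (disjoint (p , ℓ , ∧-true e Xpℓ))
    ... | false = refl

_⊆?_ : (X Y : Inc m n) → Dec (X ⊆ Y)
X ⊆? Y = all? λ p → all? λ ℓ → (X p ℓ ≟ᵇ true) →-dec (Y p ℓ ≟ᵇ true)

nonEmpty? : (X : Inc m n) → Dec (NonEmpty X)
nonEmpty? X = any? λ p → any? λ ℓ → X p ℓ ≟ᵇ true

⊆-or-witness : (X Y : Inc m n) → X ⊆ Y ⊎ ∃₂ λ p ℓ → X p ℓ ≡ true × Y p ℓ ≡ false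
⊆-or-witness X Y with any? (λ p → any? λ ℓ → (X p ℓ ≟ᵇ true) ×-dec (Y p ℓ ≟ᵇ false))
... | yes witness = inj₂ witness
... | no none = inj₁ λ p ℓ Xpℓ → Y-true p ℓ Xpℓ
  where
    Y-true : ∀ p ℓ → X p ℓ ≡ true → Y p ℓ ≡ true
    Y-true p ℓ Xpℓ with Y p ℓ in e
    ... | true  = refl
    ... | false = ⊥-elim (none (p , ℓ , Xpℓ , e))

searchable-Inc : Searchable (Inc m n) _≐_
searchable-Inc {m} {n} = searchable-Fin→ (λ _ _ → refl) (searchable-Fin→ (λ _ → refl) searchable-Bool n) m

single-self : (p : Fin m) (ℓ : Fin n) → single p ℓ p ℓ ≡ true
single-self p ℓ with p ≟ p | ℓ ≟ ℓ
... | yes _   | yes _   = refl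
... | no p≢p  | _       = ⊥-elim (p≢p refl)
... | yes _   | no ℓ≢ℓ  = ⊥-elim (ℓ≢ℓ refl)

single-true⁻ : ∀ {p p' : Fin m} {ℓ ℓ' : Fin n} → single p ℓ p' ℓ' ≡ true → p' ≡ p × ℓ' ≡ ℓ
single-true⁻ {p = p} {p'} {ℓ} {ℓ'} e with p' ≟ p | ℓ' ≟ ℓ
... | yes p'≡p | yes ℓ'≡ℓ = p'≡p , ℓ'≡ℓ

single-false : ∀ {p p' : Fin m} {ℓ ℓ' : Fin n} → p' ≢ p ⊎ ℓ' ≢ ℓ → single p ℓ p' ℓ' ≡ false
single-false {p = p} {p'} {ℓ} {ℓ'} ≢ with p' ≟ p | ℓ' ≟ ℓ | ≢
... | yes p'≡p | yes ℓ'≡ℓ | inj₁ p'≢p = ⊥-elim (p'≢p p'≡p)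
... | yes p'≡p | yes ℓ'≡ℓ | inj₂ ℓ'≢ℓ = ⊥-elim (ℓ'≢ℓ ℓ'≡ℓ)
... | yes _    | no _     | _         = refl
... | no _     | _        | _         = refl

∖-single-self : (X : Inc m n) (p : Fin m) (ℓ : Fin n) → (X ∖ single p ℓ) p ℓ ≡ false
∖-single-self X p ℓ rewrite single-self p ℓ = ∧-zeroʳ (X p ℓ)

∖-single-elsewhere : ∀ {p p' : Fin m} {ℓ ℓ' : Fin n} → single p ℓ p' ℓ' ≡ false →
  (X ∖ single p ℓ) p' ℓ' ≡ X p' ℓ'
∖-single-elsewhere {X = X} {p' = p'} {ℓ' = ℓ'} e rewrite e = ∧-identityʳ (X p' ℓ')

⊆-insert⁻ : X ⊆ insert A p ℓ → X ∖ single p ℓ ⊆ A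
⊆-insert⁻ {X = X} {A = A} {p} {ℓ} X⊆ q r e with ∖-true⁻ {X = X} {Y = single p ℓ} e
... | Xqr , not-single with ∨-true⁻ (A q r) (X⊆ q r Xqr)
...   | inj₁ Aqr = Aqr
...   | inj₂ single with () ← trans (sym single) not-single

⊆-insert-absent : X ⊆ insert A p ℓ → X p ℓ ≡ false → X ⊆ A
⊆-insert-absent {X = X} {A = A} {p} {ℓ} X⊆ Xpℓ q r Xqr with ∨-true⁻ (A q r) (X⊆ q r Xqr)
... | inj₁ Aqr = Aqr
... | inj₂ s with single-true⁻ {p = p} {q} {ℓ} {r} s
...   | refl , refl with () ← trans (sym Xqr) Xpℓ

⊆-insert : X ∖ single p ℓ ⊆ B → X ⊆ insert B p ℓ
⊆-insert {X = X} {p} {ℓ} {B = B} X∖⊆B q r Xqr with single p ℓ q r in s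
... | true  = ∨-trueʳ (B q r) refl
... | false = ∨-trueˡ _ (X∖⊆B q r (trans (∖-single-elsewhere {X = X} s) Xqr))

card-cong : X ≐ Y → card X ≡ card Y
card-cong X≐Y = sumFin-cong λ p → count-cong (X≐Y p)

card-mono : X ⊆ Y → card X ≤ card Y
card-mono X⊆Y = sumFin-mono λ p → count-mono (X⊆Y p)

card-mono-< : X ⊆ Y → ∀ p ℓ → X p ℓ ≡ false → Y p ℓ ≡ true → card X < card Y
card-mono-< X⊆Y p ℓ Xpℓ Ypℓ =
  sumFin-mono-< (λ p → count-mono (X⊆Y p)) p (count-mono-< (X⊆Y p) ℓ Xpℓ Ypℓ)

card-∪-∩ : (X Y : Inc m n) → card (X ∪ Y) + card (X ∩ Y) ≡ card X + card Y
card-∪-∩ X Y = begin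
  card (X ∪ Y) + card (X ∩ Y)                      ≡⟨ sumFin-+ (count ∘ (X ∪ Y)) (count ∘ (X ∩ Y)) ⟨
  sumFin (λ p → count ((X ∪ Y) p) + count ((X ∩ Y) p)) ≡⟨ sumFin-cong (λ p → count-∨-∧ {f = X p} {g = Y p}) ⟩
  sumFin (λ p → count (X p) + count (Y p))          ≡⟨ sumFin-+ (count ∘ X) (count ∘ Y) ⟩
  card X + card Y                                  ∎
  where open ≡-Reasoning

card-split : (X Y : Inc m n) → card X ≡ card (X ∖ Y) + card (X ∩ Y)
card-split X Y = begin
  card X                                             ≡⟨ card-cong X≐ ⟩
  card ((X ∖ Y) ∪ (X ∩ Y))                           ≡⟨ +-identityʳ _ ⟨
  card ((X ∖ Y) ∪ (X ∩ Y)) + 0                       ≡⟨ cong (card ((X ∖ Y) ∪ (X ∩ Y)) +_) (sumFin-zero λ p → count-zero (disjoint p)) ⟨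
  card ((X ∖ Y) ∪ (X ∩ Y)) + card ((X ∖ Y) ∩ (X ∩ Y)) ≡⟨ card-∪-∩ (X ∖ Y) (X ∩ Y) ⟩
  card (X ∖ Y) + card (X ∩ Y)                        ∎
  where
    open ≡-Reasoning
    X≐ : X ≐ (X ∖ Y) ∪ (X ∩ Y)
    X≐ p ℓ with X p ℓ | Y p ℓ
    ... | true  | true  = refl
    ... | true  | false = refl
    ... | false | _     = refl
    disjoint : ∀ p ℓ → ((X ∖ Y) ∩ (X ∩ Y)) p ℓ ≡ false
    disjoint p ℓ with X p ℓ | Y p ℓ
    ... | true  | true  = refl
    ... | true  | false = refl
    ... | false | _     = refl

card-empty : ¬ NonEmpty X → card X ≡ 0
card-empty empty = sumFin-zero λ p → count-zero (empty-false empty p)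

card-∖-< : Y ⊆ X → NonEmpty Y → card (X ∖ Y) < card X
card-∖-< {Y = Y} {X = X} Y⊆X (p , ℓ , Ypℓ) = card-mono-< ∖-⊆ p ℓ X∖Y-false (Y⊆X p ℓ Ypℓ)
  where
    X∖Y-false : (X ∖ Y) p ℓ ≡ false
    X∖Y-false rewrite Ypℓ = ∧-zeroʳ (X p ℓ)

card-remove : ∀ {X : Inc m n} p ℓ → X p ℓ ≡ true → card X ≡ suc (card (X ∖ single p ℓ))
card-remove {X = X} p ℓ Xpℓ =
  sumFin-suc-at p
    (λ p' p'≢p → count-cong λ ℓ' → sym (elsewhere p' ℓ' (inj₁ p'≢p)))
    (count-suc-at ℓ (λ ℓ' ℓ'≢ℓ → sym (elsewhere p ℓ' (inj₂ ℓ'≢ℓ))) Xpℓ (∖-single-self X p ℓ))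
  where
    elsewhere : ∀ p' ℓ' → p' ≢ p ⊎ ℓ' ≢ ℓ → (X ∖ single p ℓ) p' ℓ' ≡ X p' ℓ'
    elsewhere p' ℓ' ≢ = ∖-single-elsewhere {X = X} {p = p} {p'} {ℓ} {ℓ'} (single-false ≢)

points : Inc m n → Fin m → Bool
points X p = anyFin (X p)

lines : Inc m n → Fin n → Bool
lines X = points (transpose X)

points-intro : (X : Inc m n) (ℓ : Fin n) → X p ℓ ≡ true → points X p ≡ true
points-intro X ℓ = anyFin-intro ℓ

lines-intro : (X : Inc m n) (p : Fin m) → X p ℓ ≡ true → lines X ℓ ≡ true
lines-intro X p = anyFin-intro p

points-mono : X ⊆ Y → ∀ p → points X p ≡ true → points Y p ≡ true
points-mono {Y = Y} X⊆Y p e with anyFin-witness e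
... | ℓ , Xpℓ = points-intro Y ℓ (X⊆Y p ℓ Xpℓ)

lines-mono : X ⊆ Y → ∀ ℓ → lines X ℓ ≡ true → lines Y ℓ ≡ true
lines-mono X⊆Y = points-mono (⊆-transpose X⊆Y)

points-∪ : ∀ (X Y : Inc m n) p → points (X ∪ Y) p ≡ true → points X p ∨ points Y p ≡ true
points-∪ X Y p e with anyFin-witness e
... | ℓ , X∪Ypℓ with ∨-true⁻ (X p ℓ) X∪Ypℓ
...   | inj₁ Xpℓ = ∨-trueˡ (points Y p) (points-intro X ℓ Xpℓ)
...   | inj₂ Ypℓ = ∨-trueʳ (points X p) (points-intro Y ℓ Ypℓ)

points-∩ : ∀ (X Y : Inc m n) p → points (X ∩ Y) p ≡ true → points X p ∧ points Y p ≡ true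
points-∩ X Y p e with anyFin-witness e
... | ℓ , X∩Ypℓ with ∧-true⁻ (X p ℓ) X∩Ypℓ
...   | Xpℓ , Ypℓ = ∧-true (points-intro X ℓ Xpℓ) (points-intro Y ℓ Ypℓ)

cardP-mono : X ⊆ Y → cardP X ≤ cardP Y
cardP-mono X⊆Y = count-mono (points-mono X⊆Y)

-- cardL X is definitionally cardP (transpose X), so facts about lines are
-- facts about points.
cardL-mono : X ⊆ Y → cardL X ≤ cardL Y
cardL-mono X⊆Y = cardP-mono (⊆-transpose X⊆Y)

cardP-∪-∩ : (X Y : Inc m n) → cardP (X ∪ Y) + cardP (X ∩ Y) ≤ cardP X + cardP Y
cardP-∪-∩ X Y = ≤-trans (+-mono-≤ (count-mono (points-∪ X Y)) (count-mono (points-∩ X Y)))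
                        (≤-reflexive (count-∨-∧ {f = points X} {g = points Y}))

cardL-∪-∩ : (X Y : Inc m n) → cardL (X ∪ Y) + cardL (X ∩ Y) ≤ cardL X + cardL Y
cardL-∪-∩ X Y = cardP-∪-∩ (transpose X) (transpose Y)

-- Weight and tight sets

-- Coordinate i can join the support s without raising c · |s|.
free : ℕ → ∀ {k} → (Fin k → Bool) → Fin k → Bool
free c s i = (c ≡ᵇ 0) ∨ s i

free-mono : ∀ c {k} {f g : Fin k → Bool} → (∀ i → f i ≡ true → g i ≡ true) →
  ∀ i → free c f i ≡ true → free c g i ≡ true
free-mono zero    _   _ _ = refl
free-mono (suc c) f⊆g     = f⊆g

*-count-mono-free : ∀ c {k} {f g : Fin k → Bool} → (∀ i → f i ≡ true → free c g i ≡ true) →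
  c * count f ≤ c * count g
*-count-mono-free zero    _   = z≤n
*-count-mono-free (suc c) f⊆g = *-monoʳ-≤ (suc c) (count-mono f⊆g)

free-of-no-gain : ∀ c {k} {f g : Fin k → Bool} → (∀ i → f i ≡ true → g i ≡ true) →
  ∀ i → g i ≡ true → c * count g ≤ c * count f → free c f i ≡ true
free-of-no-gain zero    _             _ _  _       = refl
free-of-no-gain (suc c) {f = f} f⊆g i gi no-gain with f i in fi
... | true  = refl
... | false = ⊥-elim (<⇒≱ (*-monoʳ-< (suc c) (count-mono-< f⊆g i fi gi)) no-gain)

module Sparsity (k₁ k₂ l : ℕ) where

  weight : Inc m n → ℕ
  weight X = k₁ * cardP X + k₂ * cardL X

  Tight : Inc m n → Set
  Tight X = weight X ≤ card X + l

  span : Inc m n → Inc m n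
  span Y p ℓ = free k₁ (points Y) p ∧ free k₂ (lines Y) ℓ

  weight-mono : X ⊆ Y → weight X ≤ weight Y
  weight-mono X⊆Y = +-mono-≤ (*-monoʳ-≤ k₁ (cardP-mono X⊆Y)) (*-monoʳ-≤ k₂ (cardL-mono X⊆Y))

  weight-cong : X ≐ Y → weight X ≡ weight Y
  weight-cong X≐Y = ≤-antisym (weight-mono (≐⇒⊆ X≐Y)) (weight-mono (≐⇒⊇ X≐Y))

  weight-submodular : (X Y : Inc m n) → weight (X ∪ Y) + weight (X ∩ Y) ≤ weight X + weight Y
  weight-submodular X Y = begin
    weight (X ∪ Y) + weight (X ∩ Y)
      ≡⟨ regroup (cardP (X ∪ Y)) (cardP (X ∩ Y)) (cardL (X ∪ Y)) (cardL (X ∩ Y)) ⟩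
    k₁ * (cardP (X ∪ Y) + cardP (X ∩ Y)) + k₂ * (cardL (X ∪ Y) + cardL (X ∩ Y))
      ≤⟨ +-mono-≤ (*-monoʳ-≤ k₁ (cardP-∪-∩ X Y)) (*-monoʳ-≤ k₂ (cardL-∪-∩ X Y)) ⟩
    k₁ * (cardP X + cardP Y) + k₂ * (cardL X + cardL Y)
      ≡⟨ regroup (cardP X) (cardP Y) (cardL X) (cardL Y) ⟨
    weight X + weight Y ∎
    where
      open ≤-Reasoning
      regroup : ∀ a b c d → (k₁ * a + k₂ * c) + (k₁ * b + k₂ * d) ≡ k₁ * (a + b) + k₂ * (c + d)
      regroup a b c d = trans (interchange (k₁ * a) (k₂ * c) (k₁ * b) (k₂ * d))
                              (sym (cong₂ _+_ (*-distribˡ-+ k₁ a b) (*-distribˡ-+ k₂ c d)))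

  weight-pos : (X : Inc m n) (p : Fin m) (ℓ : Fin n) → X p ℓ ≡ true → k₁ + k₂ ≤ weight X
  weight-pos X p ℓ Xpℓ = +-mono-≤ (times-pos k₁ (count-pos p (points-intro X ℓ Xpℓ)))
                                  (times-pos k₂ (count-pos ℓ (lines-intro X p Xpℓ)))
    where
      times-pos : ∀ c {a} → 1 ≤ a → c ≤ c * a
      times-pos c 1≤a = subst₂ _≤_ (*-identityʳ c) refl (*-monoʳ-≤ c 1≤a)

  ⊆-span : Y ⊆ span Y
  ⊆-span {Y = Y} p ℓ Ypℓ =
    ∧-true (∨-trueʳ (k₁ ≡ᵇ 0) (points-intro Y ℓ Ypℓ)) (∨-trueʳ (k₂ ≡ᵇ 0) (lines-intro Y p Ypℓ))

  span-mono : X ⊆ Y → span X ⊆ span Y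
  span-mono {X = X} X⊆Y p ℓ e with ∧-true⁻ (free k₁ (points X) p) e
  ... | p-free , ℓ-free = ∧-true (free-mono k₁ (points-mono X⊆Y) p p-free)
                                 (free-mono k₂ (lines-mono X⊆Y) ℓ ℓ-free)

  weight-span : X ⊆ span Y → weight X ≤ weight Y
  weight-span {X = X} {Y = Y} X⊆ =
    +-mono-≤ (*-count-mono-free k₁ points-free) (*-count-mono-free k₂ lines-free)
    where
      points-free : ∀ p → points X p ≡ true → free k₁ (points Y) p ≡ true
      points-free p e with anyFin-witness e
      ... | ℓ , Xpℓ = proj₁ (∧-true⁻ (free k₁ (points Y) p) (X⊆ p ℓ Xpℓ))
      lines-free : ∀ ℓ → lines X ℓ ≡ true → free k₂ (lines Y) ℓ ≡ true
      lines-free ℓ e with anyFin-witness e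
      ... | p , Xpℓ = proj₂ (∧-true⁻ (free k₁ (points Y) p) (X⊆ p ℓ Xpℓ))

  Violated : Inc m n → Set
  Violated Z = ¬ (card Z + l ≤ weight Z)

  sparse-∅ : Sparse k₁ k₂ l (∅ {m} {n})
  sparse-∅ Z Z⊆∅ (p , ℓ , Zpℓ) with () ← Z⊆∅ p ℓ Zpℓ

  sparse-⊆ : X ⊆ Y → Sparse k₁ k₂ l Y → Sparse k₁ k₂ l X
  sparse-⊆ X⊆Y sparseY Z Z⊆X = sparseY Z (⊆-trans Z⊆X X⊆Y)

  sparse-or-violated : (I : Inc m n) →
    Sparse k₁ k₂ l I ⊎ ∃ λ Z → Z ⊆ I × NonEmpty Z × Violated Z
  sparse-or-violated I
    with searchable-Inc (λ Z → Z ⊆ I × NonEmpty Z × Violated Z) resp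
           (λ Z → (Z ⊆? I) ×-dec nonEmpty? Z ×-dec ¬? (card Z + l ≤? weight Z))
    where
      resp : X ≐ Y → X ⊆ I × NonEmpty X × Violated X → Y ⊆ I × NonEmpty Y × Violated Y
      resp X≐Y (X⊆I , neX , violatedX) =
        ⊆-trans (≐⇒⊇ X≐Y) X⊆I , NonEmpty-mono (≐⇒⊆ X≐Y) neX ,
        violatedX ∘ subst₂ _≤_ (cong (_+ l) (sym (card-cong X≐Y))) (sym (weight-cong X≐Y))
  ... | yes violator = inj₂ violator
  ... | no none = inj₁ λ Z Z⊆I neZ →
    decidable-stable (card Z + l ≤? weight Z) λ violated → none (Z , Z⊆I , neZ , violated)

  tight-∪ : Sparse k₁ k₂ l A → X ⊆ A → Tight X → Tight Y → NonEmpty (X ∩ Y) → Tight (X ∪ Y)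
  tight-∪ {X = X} {Y = Y} sparseA X⊆A tightX tightY meet =
    +-cancelʳ-≤ (weight (X ∩ Y)) (weight (X ∪ Y)) (card (X ∪ Y) + l) (begin
      weight (X ∪ Y) + weight (X ∩ Y)           ≤⟨ weight-submodular X Y ⟩
      weight X + weight Y                       ≤⟨ +-mono-≤ tightX tightY ⟩
      (card X + l) + (card Y + l)               ≡⟨ interchange (card X) l (card Y) l ⟩
      (card X + card Y) + (l + l)               ≡⟨ cong (_+ (l + l)) (card-∪-∩ X Y) ⟨
      (card (X ∪ Y) + card (X ∩ Y)) + (l + l)   ≡⟨ interchange (card (X ∪ Y)) (card (X ∩ Y)) l l ⟩
      (card (X ∪ Y) + l) + (card (X ∩ Y) + l)
        ≤⟨ +-monoʳ-≤ (card (X ∪ Y) + l) (sparseA (X ∩ Y) (⊆-trans ∩-⊆ˡ X⊆A) meet) ⟩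
      (card (X ∪ Y) + l) + weight (X ∩ Y)       ∎)
    where open ≤-Reasoning

  Maximal : Inc m n → Inc m n → Set
  Maximal A Y = ∀ Y' → Y' ⊆ A → Y ⊆ Y' → Tight Y' → card Y' ≤ card Y

  maximal-tight-extension : ∀ k → card A ≤ card Z + k → Z ⊆ A → Tight Z →
    ∃ λ Y → Z ⊆ Y × Y ⊆ A × Tight Y × Maximal A Y
  maximal-tight-extension {A = A} {Z = Z} zero |A|≤|Z|+0 Z⊆A tightZ =
    Z , ⊆-refl , Z⊆A , tightZ , λ Y' Y'⊆A _ _ →
      ≤-trans (card-mono Y'⊆A) (subst (card A ≤_) (+-identityʳ (card Z)) |A|≤|Z|+0)
  maximal-tight-extension {A = A} {Z = Z} (suc k) |A|≤|Z|+1+k Z⊆A tightZ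
    with searchable-Inc Enlarges resp
           (λ Y → (Y ⊆? A) ×-dec (Z ⊆? Y) ×-dec (weight Y ≤? card Y + l) ×-dec (card Z <? card Y))
    where
      Enlarges : Inc _ _ → Set
      Enlarges Y = Y ⊆ A × Z ⊆ Y × Tight Y × card Z < card Y
      resp : X ≐ Y → Enlarges X → Enlarges Y
      resp X≐Y (X⊆A , Z⊆X , tightX , |Z|<|X|) =
        ⊆-trans (≐⇒⊇ X≐Y) X⊆A , ⊆-trans Z⊆X (≐⇒⊆ X≐Y) ,
        subst₂ _≤_ (weight-cong X≐Y) (cong (_+ l) (card-cong X≐Y)) tightX ,
        subst (card Z <_) (card-cong X≐Y) |Z|<|X|
  ... | no none =
    Z , ⊆-refl , Z⊆A , tightZ , λ Y' Y'⊆A Z⊆Y' tightY' →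
      ≮⇒≥ λ |Z|<|Y'| → none (Y' , Y'⊆A , Z⊆Y' , tightY' , |Z|<|Y'|)
  ... | yes (Y , Y⊆A , Z⊆Y , tightY , |Z|<|Y|)
    with maximal-tight-extension k
           (≤-trans |A|≤|Z|+1+k (≤-trans (≤-reflexive (+-suc (card Z) k)) (+-monoˡ-≤ k |Z|<|Y|)))
           Y⊆A tightY
  ...   | Y' , Y⊆Y' , maximal = Y' , ⊆-trans Z⊆Y Y⊆Y' , maximal

  maximal-tight-absorbs : Sparse k₁ k₂ l A → Y ⊆ A → Tight Y → Maximal A Y →
    Z ⊆ A → Tight Z → NonEmpty (Y ∩ Z) → Z ⊆ Y
  maximal-tight-absorbs {Y = Y} {Z = Z} sparseA Y⊆A tightY maxY Z⊆A tightZ meet p ℓ Zpℓ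
    with Y p ℓ in Ypℓ
  ... | true  = refl
  ... | false = ⊥-elim (<⇒≱ (card-mono-< ⊆-∪ˡ p ℓ Ypℓ (∨-trueʳ (Y p ℓ) Zpℓ))
                            (maxY (Y ∪ Z) (∪-⊆ Y⊆A Z⊆A) ⊆-∪ˡ (tight-∪ sparseA Y⊆A tightY tightZ meet)))

  card-∩-span : Sparse k₁ k₂ l B → Tight Y → card (B ∩ span Y) ≤ card Y
  card-∩-span {B = B} {Y = Y} sparseB tightY with nonEmpty? (B ∩ span Y)
  ... | yes meet = +-cancelʳ-≤ l (card (B ∩ span Y)) (card Y) (begin
    card (B ∩ span Y) + l  ≤⟨ sparseB (B ∩ span Y) ∩-⊆ˡ meet ⟩
    weight (B ∩ span Y)    ≤⟨ weight-span {X = B ∩ span Y} {Y = Y} (∩-⊆ʳ {X = B}) ⟩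
    weight Y               ≤⟨ tightY ⟩
    card Y + l             ∎)
    where open ≤-Reasoning
  ... | no empty = subst (_≤ card Y) (sym (card-empty empty)) z≤n

  card-∖-span-< : Sparse k₁ k₂ l B → Y ⊆ A → Tight Y → card A < card B →
    card (A ∖ Y) < card (B ∖ span Y)
  card-∖-span-< {B = B} {Y = Y} {A = A} sparseB Y⊆A tightY |A|<|B| =
    +-cancelʳ-< (card Y) (card (A ∖ Y)) (card (B ∖ span Y)) (begin-strict
      card (A ∖ Y) + card Y                  ≤⟨ +-monoʳ-≤ (card (A ∖ Y)) (card-mono (⊆-∩ Y⊆A ⊆-refl)) ⟩
      card (A ∖ Y) + card (A ∩ Y)            ≡⟨ card-split A Y ⟨
      card A                                 <⟨ |A|<|B| ⟩
      card B                                 ≡⟨ card-split B (span Y) ⟩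
      card (B ∖ span Y) + card (B ∩ span Y)  ≤⟨ +-monoʳ-≤ (card (B ∖ span Y)) (card-∩-span sparseB tightY) ⟩
      card (B ∖ span Y) + card Y             ∎)
    where open ≤-Reasoning

  record Obstruction (A : Inc m n) (p : Fin m) (ℓ : Fin n) (Z : Inc m n) : Set where
    field
      ⊆A       : Z ⊆ A
      nonEmpty : NonEmpty Z
      tight    : Tight Z
      spans    : span Z p ℓ ≡ true

  open Obstruction

  Augmentation : Inc m n → Inc m n → Set
  Augmentation {m} {n} A B = Σ (Fin m) λ p → Σ (Fin n) λ ℓ →
    B p ℓ ≡ true × A p ℓ ≡ false × Sparse k₁ k₂ l (insert A p ℓ)

  module _ (l<k₁+k₂ : l + 1 ≤ k₁ + k₂) where

    obstruction : Sparse k₁ k₂ l A → A p ℓ ≡ false → Z ⊆ insert A p ℓ → NonEmpty Z → Violated Z →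
      Obstruction A p ℓ (Z ∖ single p ℓ)
    obstruction {A = A} {p = p} {ℓ = ℓ} {Z = Z} sparseA Apℓ Z⊆ neZ violated = record
      { ⊆A       = Z₀⊆A
      ; nonEmpty = neZ₀
      ; tight    = ≤-trans (weight-mono Z₀⊆Z) weightZ≤
      ; spans    = ∧-true
          (free-of-no-gain k₁ (points-mono Z₀⊆Z) p (points-intro Z ℓ Zpℓ)
                           (+-≤⇒≤ˡ no-gain (*-monoʳ-≤ k₂ (cardL-mono Z₀⊆Z))))
          (free-of-no-gain k₂ (lines-mono Z₀⊆Z) ℓ (lines-intro Z p Zpℓ)
                           (+-≤⇒≤ʳ no-gain (*-monoʳ-≤ k₁ (cardP-mono Z₀⊆Z))))
      }
      where
        Z₀ = Z ∖ single p ℓ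

        Z₀⊆Z : Z₀ ⊆ Z
        Z₀⊆Z = ∖-⊆

        Z₀⊆A : Z₀ ⊆ A
        Z₀⊆A = ⊆-insert⁻ Z⊆

        Zpℓ : Z p ℓ ≡ true
        Zpℓ with Z p ℓ in e
        ... | true  = refl
        ... | false = ⊥-elim (violated (sparseA Z (⊆-insert-absent Z⊆ e) neZ))

        weightZ≤ : weight Z ≤ card Z₀ + l
        weightZ≤ = ≤-pred (subst (λ c → weight Z < c + l) (card-remove p ℓ Zpℓ) (≰⇒> violated))

        neZ₀ : NonEmpty Z₀
        neZ₀ = decidable-stable (nonEmpty? Z₀) λ empty →
          <⇒≱ (subst (_≤ k₁ + k₂) (+-comm l 1) l<k₁+k₂)
              (≤-trans (weight-pos Z p ℓ Zpℓ) (subst (λ c → weight Z ≤ c + l) (card-empty empty) weightZ≤))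

        no-gain : weight Z ≤ weight Z₀
        no-gain = ≤-trans weightZ≤ (sparseA Z₀ Z₀⊆A neZ₀)

    sparse-insert-lift : Sparse k₁ k₂ l A → Y ⊆ A → Tight Y → Maximal A Y →
      span Y p ℓ ≡ false → A p ℓ ≡ false →
      Sparse k₁ k₂ l (insert (A ∖ Y) p ℓ) → Sparse k₁ k₂ l (insert A p ℓ)
    sparse-insert-lift {A = A} {Y = Y} {p = p} {ℓ = ℓ}
                       sparseA Y⊆A tightY maxY outside Apℓ sparse′ Z Z⊆ neZ =
      decidable-stable (card Z + l ≤? weight Z) λ violated →
        refute (obstruction sparseA Apℓ Z⊆ neZ violated) violated (nonEmpty? (Y ∩ (Z ∖ single p ℓ)))
      where
        refute : Obstruction A p ℓ (Z ∖ single p ℓ) → Violated Z →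
                 Dec (NonEmpty (Y ∩ (Z ∖ single p ℓ))) → ⊥
        refute O _ (yes meet)
          with () ← trans (sym (span-mono (maximal-tight-absorbs sparseA Y⊆A tightY maxY (⊆A O) (tight O) meet)
                                          p ℓ (spans O)))
                          outside
        refute O violated (no disjoint) = violated (sparse′ Z (⊆-insert (⊆-∖ (⊆A O) disjoint)) neZ)

    lift-augmentation : Sparse k₁ k₂ l A → Y ⊆ A → Tight Y → Maximal A Y →
      Augmentation (A ∖ Y) (B ∖ span Y) → Augmentation A B
    lift-augmentation {A = A} {Y = Y} {B = B} sparseA Y⊆A tightY maxY (p , ℓ , in-B′ , out-A′ , sparse′) =
      p , ℓ , Bpℓ , Apℓ , sparse-insert-lift sparseA Y⊆A tightY maxY outside Apℓ sparse′
      where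
        Bpℓ : B p ℓ ≡ true
        Bpℓ = proj₁ (∖-true⁻ {X = B} {Y = span Y} in-B′)
        outside : span Y p ℓ ≡ false
        outside = proj₂ (∖-true⁻ {X = B} {Y = span Y} in-B′)
        Apℓ : A p ℓ ≡ false
        Apℓ = ∖-false {X = A} {Y = Y} out-A′ (⊆-false (⊆-span {Y = Y}) outside)

    augment : ∀ k → card A < k → Sparse k₁ k₂ l A → Sparse k₁ k₂ l B → card A < card B →
      Augmentation A B
    augment {A = A} {B = B} (suc k) |A|<1+k sparseA sparseB |A|<|B| with ⊆-or-witness B A
    ... | inj₁ B⊆A = ⊥-elim (<⇒≱ |A|<|B| (card-mono B⊆A))
    ... | inj₂ (p , ℓ , Bpℓ , Apℓ) with sparse-or-violated (insert A p ℓ)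
    ...   | inj₁ sparse = p , ℓ , Bpℓ , Apℓ , sparse
    ...   | inj₂ (Z , Z⊆ , neZ , violated) with obstruction sparseA Apℓ Z⊆ neZ violated
    ...     | O with maximal-tight-extension (card A) (m≤n+m (card A) _) (⊆A O) (tight O)
    ...       | Y , Z₀⊆Y , Y⊆A , tightY , maxY =
      lift-augmentation sparseA Y⊆A tightY maxY
        (augment k (<-≤-trans (card-∖-< Y⊆A (NonEmpty-mono Z₀⊆Y (nonEmpty O))) (≤-pred |A|<1+k))
                   (sparse-⊆ ∖-⊆ sparseA) (sparse-⊆ ∖-⊆ sparseB)
                   (card-∖-span-< sparseB Y⊆A tightY |A|<|B|))

-- No size bound is needed: the sparse sets form a matroid on every P × L.
theorem7 : (k₁ k₂ l : ℕ) → l + 1 ≤ k₁ + k₂ →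
    Σ ℕ λ N → (m n : ℕ) → N ≤ m → N ≤ n →
    IsMatroid {m} {n} (Sparse k₁ k₂ l)
theorem7 k₁ k₂ l l<k₁+k₂ = 0 , λ m n _ _ → record
  { empty-ind   = sparse-∅
  ; down-closed = λ A B → sparse-⊆
  ; augment     = λ A B sparseA sparseB → augment l<k₁+k₂ (suc (card A)) ≤-refl sparseA sparseB
  }
  where open Sparsity k₁ k₂ l
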